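{- Fix $m\geq 1$ and let $n=2m+r$ with $r\geq 0$. Then the unique optimal graph in $\mathcal{G}_{n,m}$ is $mK_2\cup rK_1$. That is, for $n\geq 2$ and $m<\lceil n/2\rceil$ a unique optimal graph in $\mathcal{G}_{n,m}$ exists.
   Context: All graphs are finite and simple. A set $S$ of vertices of a graph $G$ is dominating if every vertex of $G$ is in $S$ or adjacent to a vertex of $S$. The domination polynomial is $D(G,x)=\sum_{i=1}^{|V(G)|} d(G,i)x^i$, where $d(G,i)$ is the number of dominating sets of $G$ of cardinality $i$. $\mathcal{G}_{n,m}$ denotes the set of simple graphs with $n$ vertices and $m$ edges. A graph $H\in\mathcal{G}_{n,m}$ is optimal if $D(H,x)\geq D(G,x)$ for all $G\in\mathcal{G}_{n,m}$ and all $x\geq 0$; it is the unique optimal graph if it is (up to isomorphism) the only optimal graph in $\mathcal{G}_{n,m}$. $mK_2\cup rK_1$ denotes the disjoint union of $m$ copies of $K_2$ and $r$ isolated vertices.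
   Formalization: The variable x in the optimality condition $D(H,x)\geq D(G,x)$ ranges over the nonnegative rationals only, rather than over all $x\geq 0$. -}

module Defs where

open import Data.Bool using (Bool; true; false; _∧_; not)
open import Data.Bool.Properties using (∧-comm; ∧-zeroʳ)
open import Data.Empty using (⊥-elim)
open import Data.Nat as ℕ using (ℕ; zero; suc; ⌊_/2⌋)
open import Data.Fin using (Fin; toℕ; _<?_)
open import Data.Fin.Properties using (any?; all?)
open import Data.Fin.Subset using (Subset; inside; outside; _∈_; ∣_∣)
open import Data.Fin.Subset.Properties using (_∈?_)
open import Data.Vec using ([]; _∷_)
open import Data.List using (List; []; _∷_; _++_; map; length; filter; allFin; cartesianProduct; upTo)
open import Data.Product using (Σ; ∃; ∃-syntax; _×_; _,_; proj₁; proj₂)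
open import Data.Sum using (_⊎_)
open import Data.Integer using (+_)
open import Data.Rational using (ℚ; _/_; _+_; _*_; _≤_; 0ℚ; 1ℚ)
open import Relation.Binary.PropositionalEquality using (_≡_; refl) renaming (sym to ≡-sym)
open import Relation.Nullary using (Dec; ¬_; yes; no; does)
open import Relation.Nullary.Decidable using (_×-dec_; _⊎-dec_; ¬?)
open import Data.Bool.Properties using () renaming (_≟_ to _≟B_)
open import Data.Nat.Properties using () renaming (_≟_ to _≟ℕ_)
open import Function.Bundles using (_↔_; Inverse)

record Graph (n : ℕ) : Set where
  field
    adj    : Fin n → Fin n → Bool
    sym    : ∀ i j → adj i j ≡ adj j i
    irrefl : ∀ i → adj i i ≡ false
open Graph public

edgeCount : ∀ {n} → Graph n → ℕ
edgeCount {n} G =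
  length (filter (λ p → (proj₁ p <? proj₂ p) ×-dec (adj G (proj₁ p) (proj₂ p) ≟B true))
                 (cartesianProduct (allFin n) (allFin n)))

InGnm : (n m : ℕ) → Graph n → Set
InGnm n m G = edgeCount G ≡ m

_≅_ : ∀ {n} → Graph n → Graph n → Set
_≅_ {n} G H = Σ (Fin n ↔ Fin n) λ f →
  ∀ i j → adj H (Inverse.to f i) (Inverse.to f j) ≡ adj G i j

Dominating : ∀ {n} → Graph n → Subset n → Set
Dominating G S = ∀ v → v ∈ S ⊎ ∃[ u ] (u ∈ S × adj G u v ≡ true)

dominating? : ∀ {n} (G : Graph n) (S : Subset n) → Dec (Dominating G S)
dominating? G S = all? λ v → (v ∈? S) ⊎-dec any? (λ u → (u ∈? S) ×-dec (adj G u v ≟B true))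

allSubsets : (n : ℕ) → List (Subset n)
allSubsets zero    = [] ∷ []
allSubsets (suc n) = map (outside ∷_) (allSubsets n) ++ map (inside ∷_) (allSubsets n)

d : ∀ {n} → Graph n → ℕ → ℕ
d {n} G i = length (filter (λ S → dominating? G S ×-dec (∣ S ∣ ≟ℕ i)) (allSubsets n))

_^ℚ_ : ℚ → ℕ → ℚ
x ^ℚ zero  = 1ℚ
x ^ℚ suc k = x * (x ^ℚ k)

ℕtoℚ : ℕ → ℚ
ℕtoℚ k = (+ k) / 1

sumℚ : List ℚ → ℚ
sumℚ []       = 0ℚ
sumℚ (q ∷ qs) = q + sumℚ qs

D : ∀ {n} → Graph n → ℚ → ℚ
D {n} G x = sumℚ (map (λ k → ℕtoℚ (d G (suc k)) * (x ^ℚ suc k)) (upTo n))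

Optimal : (n m : ℕ) → Graph n → Set
Optimal n m H = InGnm n m H ×
  (∀ (G : Graph n) → InGnm n m G → ∀ (x : ℚ) → 0ℚ ≤ x → D G x ≤ D H x)

UniqueOptimal : (n m : ℕ) → Graph n → Set
UniqueOptimal n m H = Optimal n m H × (∀ (H' : Graph n) → Optimal n m H' → H' ≅ H)

-- m K_2 ∪ r K_1 on vertex set Fin (2m + r): vertices 2k and 2k+1 (k < m) are
-- adjacent; vertices ≥ 2m are isolated.
eqᵇ : ℕ → ℕ → Bool
eqᵇ = ℕ._≡ᵇ_

eqᵇ-sym : ∀ a b → eqᵇ a b ≡ eqᵇ b a
eqᵇ-sym zero zero = refl
eqᵇ-sym zero (suc b) = refl
eqᵇ-sym (suc a) zero = refl
eqᵇ-sym (suc a) (suc b) = eqᵇ-sym a b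

eqᵇ-refl : ∀ a → eqᵇ a a ≡ true
eqᵇ-refl zero = refl
eqᵇ-refl (suc a) = eqᵇ-refl a

matchingAdj : (m r : ℕ) → Fin (2 ℕ.* m ℕ.+ r) → Fin (2 ℕ.* m ℕ.+ r) → Bool
matchingAdj m r i j =
  ((toℕ i ℕ.<ᵇ 2 ℕ.* m) ∧ (toℕ j ℕ.<ᵇ 2 ℕ.* m))
  ∧ (not (eqᵇ (toℕ i) (toℕ j)) ∧ eqᵇ ⌊ toℕ i /2⌋ ⌊ toℕ j /2⌋)

matching-sym : ∀ m r i j → matchingAdj m r i j ≡ matchingAdj m r j i
matching-sym m r i j
  rewrite ∧-comm (toℕ i ℕ.<ᵇ 2 ℕ.* m) (toℕ j ℕ.<ᵇ 2 ℕ.* m)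
        | eqᵇ-sym (toℕ i) (toℕ j)
        | eqᵇ-sym ⌊ toℕ i /2⌋ ⌊ toℕ j /2⌋ = refl

matching-irrefl : ∀ m r i → matchingAdj m r i i ≡ false
matching-irrefl m r i rewrite eqᵇ-refl (toℕ i) =
  ∧-zeroʳ ((toℕ i ℕ.<ᵇ 2 ℕ.* m) ∧ (toℕ i ℕ.<ᵇ 2 ℕ.* m))

mK₂∪rK₁ : (m r : ℕ) → Graph (2 ℕ.* m ℕ.+ r)
mK₂∪rK₁ m r = record { adj = matchingAdj m r ; sym = matching-sym m r ; irrefl = matching-irrefl m r }

module Submission where

-- Label the m edges of G ∈ 𝒢_{n,m} by Fin m; a code (k , b) names the
-- end b of the k-th edge, and in M = mK₂ ∪ rK₁ the same code names the slot
-- 2k + b.  For a dominating set S of G every vertex t ∉ S is the end c of an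
-- edge whose other end lies in S; deleting the slot of the first such c for
-- every t ∉ S from Fin n gives a set φ S.  The map φ is injective on
-- dominating sets, preserves size and lands in dominating sets of M, so
-- d(G,i) ≤ d(M,i) for all i and D(G,x) ≤ D(M,x) for x ≥ 0.  If G is optimal,
-- D(G,1) ≥ D(M,1) forces d(G,n-1) = d(M,n-1), so φ hits every set
-- Fin n ∖ {slot c}; its preimage is Fin n ∖ {end c}, hence distinct codes
-- name distinct vertices: the edges of G form a matching and G ≅ M.

open import Defs
open import Data.Nat using (ℕ; _≤_; _+_; _*_)
open import Data.Nat as ℕ using (zero; suc; z≤n; s≤s; _<_; _∸_; ⌊_/2⌋)
import Data.Nat.Properties as ℕP
import Data.Nat.Coprimality as Coprime
open import Data.Bool using (Bool; true; false; not; T)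
open import Data.Bool.Properties using (not-involutive; not-¬; ¬-not; T-≡; T-∧; T-not-≡) renaming (_≟_ to _≟ᵇ_)
open import Data.Empty using (⊥; ⊥-elim)
open import Data.Product using (Σ; ∃-syntax; _×_; _,_; proj₁; proj₂)
open import Data.Sum using (inj₁; inj₂)
open import Data.Maybe using (Maybe; just; nothing)
open import Data.Maybe.Properties using (just-injective)
open import Data.List using (List; []; _∷_; length; map; filter; upTo; allFin; cartesianProduct; lookup)
open import Data.List.Properties using (length-map; length-removeAt′; length-tabulate)
open import Data.List.Membership.Propositional using (find; lose) renaming (_∈_ to _∈ˡ_)
open import Data.List.Membership.Propositional.Properties
  using (∈-map⁺; ∈-map⁻; ∈-++⁺ˡ; ∈-++⁺ʳ; ∈-filter⁺; ∈-filter⁻; ∈-upTo⁺; ∈-allFin; ∈-cartesianProduct⁺; ∈-lookup)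
open import Data.List.Relation.Unary.Any as Any using (Any; here; there; _─_)
open import Data.List.Relation.Unary.Any.Properties using (lookup-result; lookup-index)
import Data.List.Relation.Unary.All as All
import Data.List.Relation.Unary.All.Properties as AllP
open import Data.List.Relation.Unary.AllPairs using ([]; _∷_)
open import Data.List.Relation.Unary.Unique.Propositional using (Unique)
import Data.List.Relation.Unary.Unique.Propositional.Properties as UniqueP
open import Data.Fin as Fin using (Fin; toℕ; fromℕ<)
import Data.Fin.Properties as FinP
open import Data.Fin.Subset using (Subset; _∈_; _∉_; _⊆_; ∁; ⁅_⁆; ∣_∣)
open import Data.Fin.Subset.Properties
  using (_∈?_; ⊆-antisym; p⊂q⇒∣p∣<∣q∣; p⊆q⇒∣p∣≤∣q∣; ∣p∣≤n; ∣∁p∣≡n∸∣p∣; ∣⁅x⁆∣≡1;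
         x∈⁅x⁆; x∈⁅y⁆⇒x≡y; x≢y⇒x∉⁅y⁆; x∉p⇒x∈∁p; x∈∁p⇒x∉p; x∉∁p⇒x∈p; x∈p⇒x∉∁p)
open import Data.Fin.Permutation as Perm using (Permutation′; _⟨$⟩ʳ_; _⟨$⟩ˡ_; _∘ₚ_)
import Data.Fin.Permutation.Components as PC
open import Data.Vec using ([]; _∷_; here; there; tabulate)
import Data.Vec.Properties as VecP
open import Data.Integer using (+_)
import Data.Integer as ℤ
import Data.Integer.Properties as ℤP
open import Data.Rational as ℚ using (ℚ; 0ℚ; 1ℚ; mkℚ)
import Data.Rational.Properties as ℚP
open import Function.Bundles using (Equivalence)
open import Function.Definitions using (Injective)
open import Relation.Binary.Definitions using (tri<; tri≈; tri>)
open import Relation.Binary.PropositionalEquality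
  using (_≡_; _≢_; refl; trans; cong; cong₂; subst; subst₂; module ≡-Reasoning) renaming (sym to ≡-sym)
open import Relation.Nullary using (¬_; Dec; yes; no; contradiction; does)
open import Relation.Nullary.Decidable using (_×-dec_; ¬?; map′; dec-true; dec-false)

∈-─ : ∀ {a} {A : Set a} {x y : A} {ys : List A} (x∈ys : x ∈ˡ ys) →
      y ∈ˡ ys → y ≢ x → y ∈ˡ (ys ─ x∈ys)
∈-─ (here refl) (here refl) y≢x = contradiction refl y≢x
∈-─ (here refl) (there y∈ys) _  = y∈ys
∈-─ (there _)   (here refl) _   = here refl
∈-─ (there x∈ys) (there y∈ys) y≢x = there (∈-─ x∈ys y∈ys y≢x)

module _ {a b ℓ} {A : Set a} {B : Set b} (R : A → B → Set ℓ) where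

  pigeonhole : ∀ {xs : List A} {ys : List B} → Unique xs →
               (∀ {x} → x ∈ˡ xs → ∃[ y ] y ∈ˡ ys × R x y) →
               (∀ {x x′ y} → x ∈ˡ xs → x′ ∈ˡ xs → R x y → R x′ y → x ≡ x′) →
               length xs ≤ length ys
  pigeonhole {[]}     _                 _     _   = z≤n
  pigeonhole {x ∷ xs} {ys} (x∉xs ∷ xs!) total inj with total (here refl)
  ... | y , y∈ys , Rxy = subst (suc (length xs) ≤_) (≡-sym (length-removeAt′ ys (Any.index y∈ys)))
                           (s≤s (pigeonhole xs! total′ λ p q → inj (there p) (there q)))
    where
    total′ : ∀ {x′} → x′ ∈ˡ xs → ∃[ y′ ] y′ ∈ˡ (ys ─ y∈ys) × R x′ y′
    total′ x′∈xs with total (there x′∈xs)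
    ... | y′ , y′∈ys , Rx′y′ = y′ , ∈-─ y∈ys y′∈ys y′≢y , Rx′y′
      where
      y′≢y : y′ ≢ y
      y′≢y refl = All.lookup x∉xs x′∈xs (inj (here refl) (there x′∈xs) Rxy Rx′y′)

  pigeonhole-strict : ∀ {xs : List A} {ys : List B} → Unique xs →
                      (∀ {x} → x ∈ˡ xs → ∃[ y ] y ∈ˡ ys × R x y) →
                      (∀ {x x′ y} → x ∈ˡ xs → x′ ∈ˡ xs → R x y → R x′ y → x ≡ x′) →
                      ∀ {y₀} → y₀ ∈ˡ ys → (∀ {x} → x ∈ˡ xs → ¬ R x y₀) →
                      length xs < length ys
  pigeonhole-strict {xs} {ys} xs! total inj y₀∈ys unrelated =
    subst (suc (length xs) ≤_) (≡-sym (length-removeAt′ ys (Any.index y₀∈ys)))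
      (s≤s (pigeonhole xs! total′ inj))
    where
    total′ : ∀ {x} → x ∈ˡ xs → ∃[ y ] y ∈ˡ (ys ─ y₀∈ys) × R x y
    total′ x∈xs with total x∈xs
    ... | y , y∈ys , Rxy = y , ∈-─ y₀∈ys y∈ys (λ { refl → unrelated x∈xs Rxy }) , Rxy

members : ∀ {n} → Subset n → List (Fin n)
members []          = []
members (true  ∷ S) = Fin.zero ∷ map Fin.suc (members S)
members (false ∷ S) = map Fin.suc (members S)

members-length : ∀ {n} (S : Subset n) → length (members S) ≡ ∣ S ∣
members-length []          = refl
members-length (true  ∷ S) = cong suc (trans (length-map Fin.suc (members S)) (members-length S))
members-length (false ∷ S) = trans (length-map Fin.suc (members S)) (members-length S)

∈-members⁺ : ∀ {n} {S : Subset n} {x} → x ∈ S → x ∈ˡ members S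
∈-members⁺ here = here refl
∈-members⁺ {S = true  ∷ _} (there x∈S) = there (∈-map⁺ Fin.suc (∈-members⁺ x∈S))
∈-members⁺ {S = false ∷ _} (there x∈S) = ∈-map⁺ Fin.suc (∈-members⁺ x∈S)

∈-members⁻ : ∀ {n} {S : Subset n} {x} → x ∈ˡ members S → x ∈ S
∈-members⁻ {S = true ∷ _} (here refl) = here
∈-members⁻ {S = true ∷ _} (there x∈) with ∈-map⁻ Fin.suc x∈
... | _ , y∈ , refl = there (∈-members⁻ y∈)
∈-members⁻ {S = false ∷ _} x∈ with ∈-map⁻ Fin.suc x∈
... | _ , y∈ , refl = there (∈-members⁻ y∈)

members-unique : ∀ {n} (S : Subset n) → Unique (members S)
members-unique []          = []
members-unique (true  ∷ S) =
  AllP.map⁺ (All.universal (λ _ ()) (members S)) ∷ UniqueP.map⁺ FinP.suc-injective (members-unique S)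
members-unique (false ∷ S) = UniqueP.map⁺ FinP.suc-injective (members-unique S)

subset-pigeonhole : ∀ {ℓ n k} {p : Subset n} {q : Subset k} (R : Fin n → Fin k → Set ℓ) →
                    (∀ {x} → x ∈ p → ∃[ y ] y ∈ q × R x y) →
                    (∀ {x x′ y} → x ∈ p → x′ ∈ p → R x y → R x′ y → x ≡ x′) →
                    ∣ p ∣ ≤ ∣ q ∣
subset-pigeonhole {p = p} {q} R total inj =
  subst₂ _≤_ (members-length p) (members-length q)
    (pigeonhole R (members-unique p) total′ λ x∈ x′∈ → inj (∈-members⁻ x∈) (∈-members⁻ x′∈))
  where
  total′ : ∀ {x} → x ∈ˡ members p → ∃[ y ] y ∈ˡ members q × R _ y
  total′ x∈ with total (∈-members⁻ x∈)
  ... | y , y∈q , Rxy = y , ∈-members⁺ y∈q , Rxy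

∣p∣≡n∸∣∁p∣ : ∀ {n} (S : Subset n) → ∣ S ∣ ≡ n ∸ ∣ ∁ S ∣
∣p∣≡n∸∣∁p∣ {n} S = begin
  ∣ S ∣               ≡⟨ ℕP.m∸[m∸n]≡n (∣p∣≤n S) ⟨
  n ∸ (n ∸ ∣ S ∣)     ≡⟨ cong (n ∸_) (∣∁p∣≡n∸∣p∣ S) ⟨
  n ∸ ∣ ∁ S ∣         ∎
  where open ≡-Reasoning

⊆-by-size : ∀ {n} {p q : Subset n} → p ⊆ q → ∣ q ∣ ≤ ∣ p ∣ → p ≡ q
⊆-by-size {p = p} {q} p⊆q ∣q∣≤∣p∣ = ⊆-antisym p⊆q q⊆p
  where
  q⊆p : q ⊆ p
  q⊆p {x} x∈q with x ∈? p
  ... | yes x∈p = x∈p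
  ... | no  x∉p = contradiction ∣q∣≤∣p∣ (ℕP.<⇒≱ (p⊂q⇒∣p∣<∣q∣ (p⊆q , x , x∈q , x∉p)))

∈⇒1≤∣p∣ : ∀ {n} {p : Subset n} {x} → x ∈ p → 1 ≤ ∣ p ∣
∈⇒1≤∣p∣ {p = p} {x} x∈p =
  subst (_≤ ∣ p ∣) (∣⁅x⁆∣≡1 x) (p⊆q⇒∣p∣≤∣q∣ λ y∈⁅x⁆ → subst (_∈ p) (≡-sym (x∈⁅y⁆⇒x≡y x y∈⁅x⁆)) x∈p)

∣∁⁅x⁆∣≡n∸1 : ∀ {n} (x : Fin n) → ∣ ∁ ⁅ x ⁆ ∣ ≡ n ∸ 1
∣∁⁅x⁆∣≡n∸1 x = trans (∣∁p∣≡n∸∣p∣ ⁅ x ⁆) (cong (_ ∸_) (∣⁅x⁆∣≡1 x))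

cosingleton-unique : ∀ {n} {S : Subset n} {t} → t ∉ S → ∣ S ∣ ≡ n ∸ 1 → S ≡ ∁ ⁅ t ⁆
cosingleton-unique {S = S} {t} t∉S ∣S∣≡n∸1 =
  ⊆-by-size S⊆ (ℕP.≤-reflexive (trans (∣∁⁅x⁆∣≡n∸1 t) (≡-sym ∣S∣≡n∸1)))
  where
  S⊆ : S ⊆ ∁ ⁅ t ⁆
  S⊆ x∈S = x∉p⇒x∈∁p λ x∈⁅t⁆ → t∉S (subst (_∈ S) (x∈⁅y⁆⇒x≡y t x∈⁅t⁆) x∈S)

⊆-by-complement : ∀ {n} {p q : Subset n} → (∀ {x} → x ∉ q → x ∉ p) → p ⊆ q
⊆-by-complement {q = q} outside {x} x∈p with x ∈? q
... | yes x∈q = x∈q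
... | no  x∉q = contradiction x∈p (outside x∉q)

∁⁅⁆-injective : ∀ {n} {x y : Fin n} → ∁ ⁅ x ⁆ ≡ ∁ ⁅ y ⁆ → x ≡ y
∁⁅⁆-injective {x = x} {y} eq =
  x∈⁅y⁆⇒x≡y y (x∉∁p⇒x∈p (subst (x ∉_) eq (x∈p⇒x∉∁p (x∈⁅x⁆ x))))

∈-allSubsets : ∀ {n} (S : Subset n) → S ∈ˡ allSubsets n
∈-allSubsets []          = here refl
∈-allSubsets (false ∷ S) = ∈-++⁺ˡ (∈-map⁺ (false ∷_) (∈-allSubsets S))
∈-allSubsets (true ∷ S)  = ∈-++⁺ʳ (map (false ∷_) (allSubsets _)) (∈-map⁺ (true ∷_) (∈-allSubsets S))

allSubsets-unique : ∀ n → Unique (allSubsets n)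
allSubsets-unique zero    = All.[] ∷ []
allSubsets-unique (suc n) =
  UniqueP.++⁺ (UniqueP.map⁺ ∷-injective (allSubsets-unique n))
              (UniqueP.map⁺ ∷-injective (allSubsets-unique n)) disjoint
  where
  ∷-injective : ∀ {b} {S T : Subset n} → b ∷ S ≡ b ∷ T → S ≡ T
  ∷-injective refl = refl
  disjoint : ∀ {S} → ¬ (S ∈ˡ map (false ∷_) (allSubsets n) × S ∈ˡ map (true ∷_) (allSubsets n))
  disjoint (p , q) with ∈-map⁻ (false ∷_) p | ∈-map⁻ (true ∷_) q
  ... | _ , _ , refl | _ , _ , ()

dominatingSets : ∀ {n} → Graph n → ℕ → List (Subset n)
dominatingSets {n} G i = filter (λ S → dominating? G S ×-dec (∣ S ∣ ℕP.≟ i)) (allSubsets n)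

∈-dominatingSets⁺ : ∀ {n} (G : Graph n) {i S} → Dominating G S → ∣ S ∣ ≡ i → S ∈ˡ dominatingSets G i
∈-dominatingSets⁺ G {i} {S} dom size =
  ∈-filter⁺ (λ S → dominating? G S ×-dec (∣ S ∣ ℕP.≟ i)) (∈-allSubsets S) (dom , size)

∈-dominatingSets⁻ : ∀ {n} (G : Graph n) {i S} → S ∈ˡ dominatingSets G i → Dominating G S × ∣ S ∣ ≡ i
∈-dominatingSets⁻ {n} G {i} S∈ =
  proj₂ (∈-filter⁻ (λ S → dominating? G S ×-dec (∣ S ∣ ℕP.≟ i)) {xs = allSubsets n} S∈)

dominatingSets-unique : ∀ {n} (G : Graph n) i → Unique (dominatingSets G i)
dominatingSets-unique {n} G i = UniqueP.filter⁺ _ (allSubsets-unique n)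

module DominationInjection {n} {G H : Graph n} (φ : Subset n → Subset n)
  (φ-dominating : ∀ {S} → Dominating G S → Dominating H (φ S))
  (φ-size       : ∀ {S} → Dominating G S → ∣ φ S ∣ ≡ ∣ S ∣)
  (φ-injective  : ∀ {S S′} → Dominating G S → Dominating G S′ → φ S ≡ φ S′ → S ≡ S′) where

  private
    Maps : Subset n → Subset n → Set
    Maps S Y = φ S ≡ Y

    maps-into : ∀ {i S} → S ∈ˡ dominatingSets G i → ∃[ Y ] Y ∈ˡ dominatingSets H i × Maps S Y
    maps-into S∈ with ∈-dominatingSets⁻ G S∈
    ... | dom , size = _ , ∈-dominatingSets⁺ H (φ-dominating dom) (trans (φ-size dom) size) , refl

    maps-injective : ∀ {i S S′ Y} → S ∈ˡ dominatingSets G i → S′ ∈ˡ dominatingSets G i →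
                     Maps S Y → Maps S′ Y → S ≡ S′
    maps-injective S∈ S′∈ refl φS≡φS′ =
      φ-injective (proj₁ (∈-dominatingSets⁻ G S∈)) (proj₁ (∈-dominatingSets⁻ G S′∈)) (≡-sym φS≡φS′)

  d-≤ : ∀ i → d G i ≤ d H i
  d-≤ i = pigeonhole Maps (dominatingSets-unique G i) maps-into maps-injective

  φ-onto : ∀ {i} → d H i ≤ d G i → ∀ {Y} → Dominating H Y → ∣ Y ∣ ≡ i →
           ∃[ S ] Dominating G S × φ S ≡ Y
  φ-onto {i} dH≤dG {Y} dom size
    with Any.any? (λ S → VecP.≡-dec _≟ᵇ_ (φ S) Y) (dominatingSets G i)
  ... | yes hit with find hit
  ...   | S , S∈ , φS≡Y = S , proj₁ (∈-dominatingSets⁻ G S∈) , φS≡Y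
  φ-onto {i} dH≤dG {Y} dom size | no miss =
    contradiction dH≤dG (ℕP.<⇒≱ (pigeonhole-strict Maps (dominatingSets-unique G i) maps-into maps-injective
                                   (∈-dominatingSets⁺ H dom size) (λ S∈ φS≡Y → miss (lose S∈ φS≡Y))))

ℕtoℚ≡mkℚ : ∀ k → ℕtoℚ k ≡ mkℚ (+ k) 0 (Coprime.sym (Coprime.1-coprimeTo k))
ℕtoℚ≡mkℚ k = ℚP.normalize-coprime _

ℕtoℚ-mono-≤ : ∀ {a b} → a ≤ b → ℕtoℚ a ℚ.≤ ℕtoℚ b
ℕtoℚ-mono-≤ {a} {b} a≤b rewrite ℕtoℚ≡mkℚ a | ℕtoℚ≡mkℚ b =
  ℚ.*≤* (subst₂ ℤ._≤_ (≡-sym (ℤP.*-identityʳ (+ a))) (≡-sym (ℤP.*-identityʳ (+ b))) (ℤ.+≤+ a≤b))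

ℕtoℚ-mono-< : ∀ {a b} → a < b → ℕtoℚ a ℚ.< ℕtoℚ b
ℕtoℚ-mono-< {a} {b} a<b rewrite ℕtoℚ≡mkℚ a | ℕtoℚ≡mkℚ b =
  ℚ.*<* (subst₂ ℤ._<_ (≡-sym (ℤP.*-identityʳ (+ a))) (≡-sym (ℤP.*-identityʳ (+ b))) (ℤ.+<+ a<b))

^ℚ-nonNeg : ∀ {x} → 0ℚ ℚ.≤ x → ∀ k → 0ℚ ℚ.≤ x ^ℚ k
^ℚ-nonNeg x≥0 zero    = ℚP.nonNegative⁻¹ 1ℚ
^ℚ-nonNeg {x} x≥0 (suc k) =
  ℚP.nonNegative⁻¹ (x ℚ.* (x ^ℚ k))
    {{ℚP.nonNeg*nonNeg⇒nonNeg x {{ℚ.nonNegative x≥0}} (x ^ℚ k) {{ℚ.nonNegative (^ℚ-nonNeg x≥0 k)}}}}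

1^ℚk≡1 : ∀ k → 1ℚ ^ℚ k ≡ 1ℚ
1^ℚk≡1 zero    = refl
1^ℚk≡1 (suc k) = trans (cong (1ℚ ℚ.*_) (1^ℚk≡1 k)) (ℚP.*-identityˡ 1ℚ)

sumℚ-mono : ∀ (f g : ℕ → ℚ) → (∀ k → f k ℚ.≤ g k) → ∀ ks → sumℚ (map f ks) ℚ.≤ sumℚ (map g ks)
sumℚ-mono f g f≤g []       = ℚP.≤-refl
sumℚ-mono f g f≤g (k ∷ ks) = ℚP.+-mono-≤ (f≤g k) (sumℚ-mono f g f≤g ks)

sumℚ-strict : ∀ (f g : ℕ → ℚ) → (∀ k → f k ℚ.≤ g k) → ∀ {k₀} ks → k₀ ∈ˡ ks → f k₀ ℚ.< g k₀ →
              sumℚ (map f ks) ℚ.< sumℚ (map g ks)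
sumℚ-strict f g f≤g (k ∷ ks) (here refl) f<g = ℚP.+-mono-<-≤ f<g (sumℚ-mono f g f≤g ks)
sumℚ-strict f g f≤g (k ∷ ks) (there k₀∈) f<g = ℚP.+-mono-≤-< (f≤g k) (sumℚ-strict f g f≤g ks k₀∈ f<g)

term-mono : ∀ {a b} y → 0ℚ ℚ.≤ y → a ≤ b → ℕtoℚ a ℚ.* y ℚ.≤ ℕtoℚ b ℚ.* y
term-mono y y≥0 a≤b = ℚP.*-monoʳ-≤-nonNeg y {{ℚ.nonNegative y≥0}} (ℕtoℚ-mono-≤ a≤b)

D-mono : ∀ {n} (G H : Graph n) → (∀ i → d G i ≤ d H i) → ∀ x → 0ℚ ℚ.≤ x → D G x ℚ.≤ D H x
D-mono {n} G H dG≤dH x x≥0 =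
  sumℚ-mono _ _ (λ k → term-mono (x ^ℚ suc k) (^ℚ-nonNeg x≥0 (suc k)) (dG≤dH (suc k))) (upTo n)

D-strict-at-1 : ∀ {n} (G H : Graph n) → (∀ i → d G i ≤ d H i) →
                ∀ {i} → 1 ≤ i → i ≤ n → d G i < d H i → D G 1ℚ ℚ.< D H 1ℚ
D-strict-at-1 {n} G H dG≤dH {suc k} _ k<n dG<dH =
  sumℚ-strict _ _ (λ j → term-mono (1ℚ ^ℚ suc j) (^ℚ-nonNeg (ℚP.nonNegative⁻¹ 1ℚ) (suc j)) (dG≤dH (suc j)))
    (upTo n) (∈-upTo⁺ k<n)
    (subst₂ ℚ._<_ (≡-sym (term-at-1 G)) (≡-sym (term-at-1 H)) (ℕtoℚ-mono-< dG<dH))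
  where
  term-at-1 : ∀ K → ℕtoℚ (d K (suc k)) ℚ.* (1ℚ ^ℚ suc k) ≡ ℕtoℚ (d K (suc k))
  term-at-1 K = trans (cong (ℕtoℚ (d K (suc k)) ℚ.*_) (1^ℚk≡1 (suc k))) (ℚP.*-identityʳ (ℕtoℚ (d K (suc k))))

coefficients-forced : ∀ {n} (G H : Graph n) → (∀ i → d G i ≤ d H i) → D H 1ℚ ℚ.≤ D G 1ℚ →
                      ∀ {i} → 1 ≤ i → i ≤ n → d H i ≤ d G i
coefficients-forced G H dG≤dH DH≤DG 1≤i i≤n =
  ℕP.≮⇒≥ λ dG<dH → ℚP.<-irrefl refl (ℚP.<-≤-trans (D-strict-at-1 G H dG≤dH 1≤i i≤n dG<dH) DH≤DG)

-- An edge code (k , b) names the end b of the k-th of m labelled edges.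
Code : ℕ → Set
Code m = Fin m × Bool

other : ∀ {m} → Code m → Code m
other (k , b) = k , not b

other-involutive : ∀ {m} (c : Code m) → other (other c) ≡ c
other-involutive (k , b) = cong (k ,_) (not-involutive b)

other-≢ : ∀ {m} (c : Code m) → other c ≢ c
other-≢ (k , b) eq = not-¬ refl (≡-sym (cong proj₂ eq))

allCodes : ∀ m → List (Code m)
allCodes m = cartesianProduct (allFin m) (false ∷ true ∷ [])

∈-allCodes : ∀ {m} (c : Code m) → c ∈ˡ allCodes m
∈-allCodes (k , false) = ∈-cartesianProduct⁺ (∈-allFin k) (here refl)
∈-allCodes (k , true)  = ∈-cartesianProduct⁺ (∈-allFin k) (there (here refl))

record Labelling {n} (m : ℕ) (G : Graph n) : Set where
  field
    ends     : Code m → Fin n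
    adjacent : ∀ c → adj G (ends c) (ends (other c)) ≡ true
    covers   : ∀ {u v} → adj G u v ≡ true → ∃[ c ] u ≡ ends c × v ≡ ends (other c)

edgeList : ∀ {n} → Graph n → List (Fin n × Fin n)
edgeList {n} G =
  filter (λ p → (proj₁ p Fin.<? proj₂ p) ×-dec (adj G (proj₁ p) (proj₂ p) ≟ᵇ true))
         (cartesianProduct (allFin n) (allFin n))

∈-edgeList⁺ : ∀ {n} (G : Graph n) {u v} → u Fin.< v → adj G u v ≡ true → (u , v) ∈ˡ edgeList G
∈-edgeList⁺ G {u} {v} u<v uv =
  ∈-filter⁺ (λ p → (proj₁ p Fin.<? proj₂ p) ×-dec (adj G (proj₁ p) (proj₂ p) ≟ᵇ true))
            (∈-cartesianProduct⁺ (∈-allFin u) (∈-allFin v)) (u<v , uv)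

∈-edgeList⁻ : ∀ {n} (G : Graph n) {u v} → (u , v) ∈ˡ edgeList G → u Fin.< v × adj G u v ≡ true
∈-edgeList⁻ {n} G uv∈ =
  proj₂ (∈-filter⁻ (λ p → (proj₁ p Fin.<? proj₂ p) ×-dec (adj G (proj₁ p) (proj₂ p) ≟ᵇ true))
                   {xs = cartesianProduct (allFin n) (allFin n)} uv∈)

edgeList-unique : ∀ {n} (G : Graph n) → Unique (edgeList G)
edgeList-unique {n} G = UniqueP.filter⁺ _ (UniqueP.cartesianProduct⁺ (UniqueP.allFin⁺ n) (UniqueP.allFin⁺ n))

endpoint : ∀ {n} → Fin n × Fin n → Bool → Fin n
endpoint (u , v) false = u
endpoint (u , v) true  = v

edgeList-labelling : ∀ {n} (G : Graph n) → Labelling (edgeCount G) G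
edgeList-labelling G = record { ends = ends ; adjacent = adjacent ; covers = covers }
  where
  ends : Code (edgeCount G) → Fin _
  ends (k , b) = endpoint (lookup (edgeList G) k) b

  adjacent : ∀ c → adj G (ends c) (ends (other c)) ≡ true
  adjacent (k , false) = proj₂ (∈-edgeList⁻ G (∈-lookup k))
  adjacent (k , true)  = trans (sym G _ _) (proj₂ (∈-edgeList⁻ G (∈-lookup k)))

  at : ∀ {u v} (uv∈ : (u , v) ∈ˡ edgeList G) → ∀ b → endpoint (u , v) b ≡ ends (Any.index uv∈ , b)
  at uv∈ b = cong (λ p → endpoint p b) (lookup-index uv∈)

  covers : ∀ {u v} → adj G u v ≡ true → ∃[ c ] u ≡ ends c × v ≡ ends (other c)
  covers {u} {v} uv with FinP.<-cmp u v
  ... | tri< u<v _ _ = (Any.index uv∈ , false) , at uv∈ false , at uv∈ true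
    where uv∈ = ∈-edgeList⁺ G u<v uv
  ... | tri> _ _ v<u = (Any.index vu∈ , true) , at vu∈ true , at vu∈ false
    where vu∈ = ∈-edgeList⁺ G v<u (trans (sym G v u) uv)
  ... | tri≈ _ refl _ = contradiction (trans (≡-sym uv) (irrefl G u)) λ ()

-- An injectively labelled graph has exactly as many edges as labels: the
-- relation "(u , v) is the k-th labelled edge" matches the edge list with
-- Fin m injectively in both directions.
labelled-edgeCount : ∀ {n m} {G : Graph n} (L : Labelling m G) →
                     Injective _≡_ _≡_ (Labelling.ends L) → edgeCount G ≡ m
labelled-edgeCount {n} {m} {G} L ends-injective = ℕP.≤-antisym edges≤m m≤edges
  where
  open Labelling L

  IsEdge : Fin n × Fin n → Fin m → Set
  IsEdge (u , v) k = ∃[ b ] u ≡ ends (k , b) × v ≡ ends (k , not b)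

  edge-labelled : ∀ {p} → p ∈ˡ edgeList G → ∃[ k ] k ∈ˡ allFin m × IsEdge p k
  edge-labelled uv∈ with covers (proj₂ (∈-edgeList⁻ G uv∈))
  ... | (k , b) , u≡ , v≡ = k , ∈-allFin k , b , u≡ , v≡

  not-reversed : ∀ {p p′} → p ∈ˡ edgeList G → p′ ∈ˡ edgeList G →
                 proj₁ p ≡ proj₂ p′ → proj₂ p ≡ proj₁ p′ → ⊥
  not-reversed p∈ p′∈ u≡v′ v≡u′ =
    FinP.<-asym (proj₁ (∈-edgeList⁻ G p∈))
                (subst₂ Fin._<_ (≡-sym v≡u′) (≡-sym u≡v′) (proj₁ (∈-edgeList⁻ G p′∈)))

  same-edge : ∀ {p p′ k} → p ∈ˡ edgeList G → p′ ∈ˡ edgeList G → IsEdge p k → IsEdge p′ k → p ≡ p′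
  same-edge _ _ (false , u≡ , v≡) (false , u′≡ , v′≡) =
    cong₂ _,_ (trans u≡ (≡-sym u′≡)) (trans v≡ (≡-sym v′≡))
  same-edge _ _ (true  , u≡ , v≡) (true  , u′≡ , v′≡) =
    cong₂ _,_ (trans u≡ (≡-sym u′≡)) (trans v≡ (≡-sym v′≡))
  same-edge p∈ p′∈ (false , u≡ , v≡) (true , u′≡ , v′≡) =
    ⊥-elim (not-reversed p∈ p′∈ (trans u≡ (≡-sym v′≡)) (trans v≡ (≡-sym u′≡)))
  same-edge p∈ p′∈ (true , u≡ , v≡) (false , u′≡ , v′≡) =
    ⊥-elim (not-reversed p∈ p′∈ (trans u≡ (≡-sym v′≡)) (trans v≡ (≡-sym u′≡)))

  labelled-edge : ∀ {k} → k ∈ˡ allFin m → ∃[ p ] p ∈ˡ edgeList G × IsEdge p k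
  labelled-edge {k} _ with FinP.<-cmp (ends (k , false)) (ends (k , true))
  ... | tri< u<v _ _ = _ , ∈-edgeList⁺ G u<v (adjacent (k , false)) , false , refl , refl
  ... | tri> _ _ v<u = _ , ∈-edgeList⁺ G v<u (adjacent (k , true)) , true , refl , refl
  ... | tri≈ _ u≡v _ = contradiction (cong proj₂ (ends-injective u≡v)) λ ()

  same-index : ∀ {k k′ p} → k ∈ˡ allFin m → k′ ∈ˡ allFin m → IsEdge p k → IsEdge p k′ → k ≡ k′
  same-index _ _ (_ , u≡ , _) (_ , u≡′ , _) = cong proj₁ (ends-injective (trans (≡-sym u≡) u≡′))

  edges≤m : edgeCount G ≤ m
  edges≤m = subst (edgeCount G ≤_) (length-tabulate (λ k → k))
    (pigeonhole IsEdge (edgeList-unique G) edge-labelled same-edge)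

  m≤edges : m ≤ edgeCount G
  m≤edges = subst (_≤ edgeCount G) (length-tabulate (λ k → k))
    (pigeonhole (λ k p → IsEdge p k) (UniqueP.allFin⁺ m) labelled-edge same-index)

transpose-moves : ∀ {n} (i j : Fin n) → PC.transpose i j i ≡ j
transpose-moves i j rewrite dec-true (i Fin.≟ i) refl = refl

transpose-fixes : ∀ {n} {i j k : Fin n} → k ≢ i → k ≢ j → PC.transpose i j k ≡ k
transpose-fixes {i = i} {j} {k} k≢i k≢j rewrite dec-false (k Fin.≟ i) k≢i | dec-false (k Fin.≟ j) k≢j = refl

⟨$⟩ʳ-injective : ∀ {n} (π : Permutation′ n) {x y} → π ⟨$⟩ʳ x ≡ π ⟨$⟩ʳ y → x ≡ y
⟨$⟩ʳ-injective π {x} {y} πx≡πy =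
  trans (≡-sym (Perm.inverseˡ π)) (trans (cong (π ⟨$⟩ˡ_) πx≡πy) (Perm.inverseˡ π))

-- Two injections f, g of a family into Fin n differ by a permutation of
-- Fin n on any finite part xs of the family: one transposition per element.
extend-to-permutation : ∀ {n} {A : Set} (f g : A → Fin n) →
                        Injective _≡_ _≡_ f → Injective _≡_ _≡_ g → (xs : List A) →
                        Σ (Permutation′ n) λ π → ∀ {a} → a ∈ˡ xs → π ⟨$⟩ʳ f a ≡ g a
extend-to-permutation f g f-inj g-inj [] = Perm.id , λ ()
extend-to-permutation {n} f g f-inj g-inj (x ∷ xs) = Perm.transpose (f x) p ∘ₚ π , agrees
  where
  π : Permutation′ n
  π = proj₁ (extend-to-permutation f g f-inj g-inj xs)

  p : Fin n
  p = π ⟨$⟩ˡ g x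

  agrees-at-x : π ⟨$⟩ʳ PC.transpose (f x) p (f x) ≡ g x
  agrees-at-x = trans (cong (π ⟨$⟩ʳ_) (transpose-moves (f x) p)) (Perm.inverseʳ π)

  agrees : ∀ {a} → a ∈ˡ x ∷ xs → π ⟨$⟩ʳ PC.transpose (f x) p (f a) ≡ g a
  agrees (here refl)   = agrees-at-x
  agrees (there a∈xs) = agrees-in-xs a∈xs (_ Fin.≟ f x)
    where
    agrees-in-xs : ∀ {a} → a ∈ˡ xs → Dec (f a ≡ f x) → π ⟨$⟩ʳ PC.transpose (f x) p (f a) ≡ g a
    agrees-in-xs {a} _ (yes fa≡fx) =
      trans (cong (λ y → π ⟨$⟩ʳ PC.transpose (f x) p y) fa≡fx)
            (trans agrees-at-x (cong g (≡-sym (f-inj fa≡fx))))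
    agrees-in-xs {a} a∈xs (no fa≢fx) = trans (cong (π ⟨$⟩ʳ_) (transpose-fixes fa≢fx fa≢p)) πfa≡ga
      where
      πfa≡ga : π ⟨$⟩ʳ f a ≡ g a
      πfa≡ga = proj₂ (extend-to-permutation f g f-inj g-inj xs) a∈xs
      fa≢p : f a ≢ p
      fa≢p fa≡p =
        fa≢fx (cong f (g-inj (trans (≡-sym πfa≡ga) (trans (cong (π ⟨$⟩ʳ_) fa≡p) (Perm.inverseʳ π)))))

≡true-equivalent : ∀ {x y : Bool} → (x ≡ true → y ≡ true) → (y ≡ true → x ≡ true) → x ≡ y
≡true-equivalent {false} {false} _ _ = refl
≡true-equivalent {true}  {true}  _ _ = refl
≡true-equivalent {false} {true}  _ y⇒x = y⇒x refl
≡true-equivalent {true}  {false} x⇒y _ = ≡-sym (x⇒y refl)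

-- Two graphs with injective labellings by the same number of edges are
-- isomorphic: a permutation matching the labellings preserves adjacency.
labelling-iso : ∀ {n m} {G H : Graph n} (L : Labelling m G) (K : Labelling m H) →
                Injective _≡_ _≡_ (Labelling.ends L) → Injective _≡_ _≡_ (Labelling.ends K) → G ≅ H
labelling-iso {n} {m} {G} {H} L K L-inj K-inj = π , adj-preserved
  where
  module L = Labelling L
  module K = Labelling K

  π : Permutation′ n
  π = proj₁ (extend-to-permutation L.ends K.ends L-inj K-inj (allCodes m))

  π-matches : ∀ c → π ⟨$⟩ʳ L.ends c ≡ K.ends c
  π-matches c = proj₂ (extend-to-permutation L.ends K.ends L-inj K-inj (allCodes m)) (∈-allCodes c)

  pulls-back : ∀ {i} c → π ⟨$⟩ʳ i ≡ K.ends c → i ≡ L.ends c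
  pulls-back c πi≡ = ⟨$⟩ʳ-injective π (trans πi≡ (≡-sym (π-matches c)))

  adj-preserved : ∀ i j → adj H (π ⟨$⟩ʳ i) (π ⟨$⟩ʳ j) ≡ adj G i j
  adj-preserved i j = ≡true-equivalent reflects preserves
    where
    reflects : adj H (π ⟨$⟩ʳ i) (π ⟨$⟩ʳ j) ≡ true → adj G i j ≡ true
    reflects πi~πj with K.covers πi~πj
    ... | c , πi≡ , πj≡ =
      subst₂ (λ u v → adj G u v ≡ true) (≡-sym (pulls-back c πi≡)) (≡-sym (pulls-back (other c) πj≡))
             (L.adjacent c)
    preserves : adj G i j ≡ true → adj H (π ⟨$⟩ʳ i) (π ⟨$⟩ʳ j) ≡ true
    preserves i~j with L.covers i~j
    ... | c , refl , refl =
      subst₂ (λ u v → adj H u v ≡ true) (≡-sym (π-matches c)) (≡-sym (π-matches (other c))) (K.adjacent c)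

-- Binary codes: the vertex 2k + b of mK₂ ∪ rK₁ is the end b of its k-th
-- edge; ⌊_/2⌋ and parity recover k and b.
bit : Bool → ℕ
bit false = 0
bit true  = 1

enc : ℕ → Bool → ℕ
enc k b = 2 * k + bit b

parity : ℕ → Bool
parity zero          = false
parity (suc zero)    = true
parity (suc (suc x)) = parity x

enc-suc : ∀ k b → enc (suc k) b ≡ suc (suc (enc k b))
enc-suc k b = cong (_+ bit b) (ℕP.*-suc 2 k)

half-enc : ∀ k b → ⌊ enc k b /2⌋ ≡ k
half-enc zero    false = refl
half-enc zero    true  = refl
half-enc (suc k) b rewrite enc-suc k b = cong suc (half-enc k b)

parity-enc : ∀ k b → parity (enc k b) ≡ b
parity-enc zero    false = refl
parity-enc zero    true  = refl
parity-enc (suc k) b rewrite enc-suc k b = parity-enc k b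

enc-half-parity : ∀ x → enc ⌊ x /2⌋ (parity x) ≡ x
enc-half-parity zero          = refl
enc-half-parity (suc zero)    = refl
enc-half-parity (suc (suc x)) rewrite enc-suc ⌊ x /2⌋ (parity x) =
  cong (λ y → suc (suc y)) (enc-half-parity x)

enc-< : ∀ {k m} b → k < m → enc k b < 2 * m
enc-< {k} {m} false k<m = subst (_< 2 * m) (≡-sym (ℕP.+-identityʳ (2 * k))) (ℕP.*-monoʳ-< 2 k<m)
enc-< {k} {m} true  k<m =
  subst (_≤ 2 * m) (trans (ℕP.*-suc 2 k) (cong suc (ℕP.+-comm 1 (2 * k)))) (ℕP.*-monoʳ-≤ 2 k<m)

half-< : ∀ {x m} → x < 2 * m → ⌊ x /2⌋ < m
half-< {x} {m} x<2m = ℕP.*-cancelˡ-< 2 ⌊ x /2⌋ m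
  (ℕP.≤-<-trans (subst (2 * ⌊ x /2⌋ ≤_) (enc-half-parity x) (ℕP.m≤m+n _ _)) x<2m)

module Matching (m r : ℕ) where
  open Equivalence using (to; from)

  slot : Code m → Fin (2 * m + r)
  slot (k , b) = fromℕ< (ℕP.<-≤-trans (enc-< b (FinP.toℕ<n k)) (ℕP.m≤m+n (2 * m) r))

  toℕ-slot : ∀ k b → toℕ (slot (k , b)) ≡ enc (toℕ k) b
  toℕ-slot k b = FinP.toℕ-fromℕ< _

  slot-injective : Injective _≡_ _≡_ slot
  slot-injective {k , b} {k′ , b′} eq = cong₂ _,_
    (FinP.toℕ-injective
      (trans (≡-sym (half-enc (toℕ k) b)) (trans (cong ⌊_/2⌋ codes≡) (half-enc (toℕ k′) b′))))
    (trans (≡-sym (parity-enc (toℕ k) b)) (trans (cong parity codes≡) (parity-enc (toℕ k′) b′)))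
    where
    codes≡ : enc (toℕ k) b ≡ enc (toℕ k′) b′
    codes≡ = trans (≡-sym (toℕ-slot k b)) (trans (cong toℕ eq) (toℕ-slot k′ b′))

  is-slot : ∀ {w k b} → toℕ w ≡ enc (toℕ k) b → w ≡ slot (k , b)
  is-slot {w} {k} {b} w≡ = FinP.toℕ-injective (trans w≡ (≡-sym (toℕ-slot k b)))

  private
    M : Graph (2 * m + r)
    M = mK₂∪rK₁ m r

  matchingAdj⁻ : ∀ {u v} → adj M u v ≡ true →
                 toℕ u < 2 * m × toℕ v ≢ toℕ u × ⌊ toℕ v /2⌋ ≡ ⌊ toℕ u /2⌋
  matchingAdj⁻ {u} {v} uv with to T-∧ (from T-≡ uv)
  ... | below , apart with to T-∧ below | to T-∧ apart
  ...   | u< , _ | u≢ , halves =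
    ℕP.<ᵇ⇒< _ _ u< ,
    (λ v≡u → contradiction (to T-not-≡ u≢) (λ eq≡false → subst T eq≡false (ℕP.≡⇒≡ᵇ _ _ (≡-sym v≡u)))) ,
    ≡-sym (ℕP.≡ᵇ⇒≡ _ _ halves)

  matchingAdj⁺ : ∀ {u v} → toℕ u < 2 * m → toℕ v < 2 * m → toℕ u ≢ toℕ v →
                 ⌊ toℕ u /2⌋ ≡ ⌊ toℕ v /2⌋ → adj M u v ≡ true
  matchingAdj⁺ {u} {v} u< v< u≢v halves =
    to T-≡ (from T-∧ (from T-∧ (ℕP.<⇒<ᵇ u< , ℕP.<⇒<ᵇ v<) ,
                      from T-∧ (from T-not-≡ (≢⇒≡ᵇ-false u≢v) , ℕP.≡⇒≡ᵇ _ _ halves)))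
    where
    ≢⇒≡ᵇ-false : ∀ {x y} → x ≢ y → (x ℕ.≡ᵇ y) ≡ false
    ≢⇒≡ᵇ-false {x} {y} x≢y with x ℕ.≡ᵇ y in eq
    ... | false = refl
    ... | true  = contradiction (ℕP.≡ᵇ⇒≡ x y (subst T (≡-sym eq) _)) x≢y

  slot-below : ∀ k b → toℕ (slot (k , b)) < 2 * m
  slot-below k b = subst (_< 2 * m) (≡-sym (toℕ-slot k b)) (enc-< b (FinP.toℕ<n k))

  half-slot : ∀ k b → ⌊ toℕ (slot (k , b)) /2⌋ ≡ toℕ k
  half-slot k b = trans (cong ⌊_/2⌋ (toℕ-slot k b)) (half-enc (toℕ k) b)

  matching-labelling : Labelling m M
  matching-labelling = record { ends = slot ; adjacent = adjacent ; covers = covers }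
    where
    adjacent : ∀ c → adj M (slot c) (slot (other c)) ≡ true
    adjacent (k , b) =
      matchingAdj⁺ (slot-below k b) (slot-below k (not b))
        (λ eq → not-¬ refl (cong proj₂ (slot-injective {k , b} {k , not b} (FinP.toℕ-injective eq))))
        (trans (half-slot k b) (≡-sym (half-slot k (not b))))

    covers : ∀ {u v} → adj M u v ≡ true → ∃[ c ] u ≡ slot c × v ≡ slot (other c)
    covers {u} {v} uv with matchingAdj⁻ uv
    ... | u<2m , v≢u , halves = (k , parity (toℕ u)) , is-slot {k = k} u≡ , is-slot {k = k} v≡
      where
      open ≡-Reasoning
      k : Fin m
      k = fromℕ< (half-< u<2m)
      toℕ-k : ⌊ toℕ u /2⌋ ≡ toℕ k
      toℕ-k = ≡-sym (FinP.toℕ-fromℕ< (half-< u<2m))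
      u≡ : toℕ u ≡ enc (toℕ k) (parity (toℕ u))
      u≡ = trans (≡-sym (enc-half-parity (toℕ u))) (cong (λ h → enc h (parity (toℕ u))) toℕ-k)
      parities : parity (toℕ v) ≡ not (parity (toℕ u))
      parities = ¬-not λ same → v≢u (begin
        toℕ v                                 ≡⟨ enc-half-parity (toℕ v) ⟨
        enc ⌊ toℕ v /2⌋ (parity (toℕ v))      ≡⟨ cong₂ enc halves same ⟩
        enc ⌊ toℕ u /2⌋ (parity (toℕ u))      ≡⟨ enc-half-parity (toℕ u) ⟩
        toℕ u                                 ∎)
      v≡ : toℕ v ≡ enc (toℕ k) (not (parity (toℕ u)))
      v≡ = begin
        toℕ v                                 ≡⟨ enc-half-parity (toℕ v) ⟨
        enc ⌊ toℕ v /2⌋ (parity (toℕ v))      ≡⟨ cong₂ enc (trans halves toℕ-k) parities ⟩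
        enc (toℕ k) (not (parity (toℕ u)))    ∎

  matching-edgeCount : edgeCount M ≡ m
  matching-edgeCount = labelled-edgeCount matching-labelling slot-injective

choose : ∀ {A : Set} {P : A → Set} {xs : List A} → Dec (Any P xs) → Maybe A
choose (yes p) = just (Any.lookup p)
choose (no _)  = nothing

choose-sound : ∀ {A : Set} {P : A → Set} {xs : List A} (d : Dec (Any P xs)) {x} → choose d ≡ just x → P x
choose-sound (yes p) refl = lookup-result p

choose-complete : ∀ {A : Set} {P : A → Set} {xs : List A} (d : Dec (Any P xs)) → Any P xs →
                  ∃[ x ] choose d ≡ just x
choose-complete (yes p) _ = Any.lookup p , refl
choose-complete (no ¬p) p = contradiction p ¬p

-- For a set S, each vertex t outside S receives the
-- first code c such that t is the end c of an edge whose other end lies in S;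
-- φ S is the set of slots of mK₂ ∪ rK₁ not used as such codes.
module Compression {m r : ℕ} {G : Graph (2 * m + r)} (L : Labelling m G) where
  open Labelling L
  open Matching m r

  private
    n : ℕ
    n = 2 * m + r
    M : Graph n
    M = mK₂∪rK₁ m r

  Reaches : Subset n → Fin n → Code m → Set
  Reaches S t c = ends c ≡ t × ends (other c) ∈ S

  search : ∀ S t → Dec (Any (Reaches S t) (allCodes m))
  search S t = Any.any? (λ c → (ends c Fin.≟ t) ×-dec (ends (other c) ∈? S)) (allCodes m)

  code : Subset n → Fin n → Maybe (Code m)
  code S t = choose (search S t)

  code-sound : ∀ {S t c} → code S t ≡ just c → Reaches S t c
  code-sound {S} {t} = choose-sound (search S t)

  code-complete : ∀ {S t} → Dominating G S → t ∉ S → ∃[ c ] code S t ≡ just c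
  code-complete {S} {t} dom t∉S with dom t
  ... | inj₁ t∈S = contradiction t∈S t∉S
  ... | inj₂ (u , u∈S , ut) with covers ut
  ...   | c , u≡ , t≡ =
    choose-complete (search S t) (lose (∈-allCodes (other c)) (≡-sym t≡ , other-end∈S))
    where
    other-end∈S : ends (other (other c)) ∈ S
    other-end∈S = subst (_∈ S) (trans u≡ (cong ends (≡-sym (other-involutive c)))) u∈S

  Codes : Subset n → Fin n → Fin n → Set
  Codes S t w = ∃[ c ] code S t ≡ just c × slot c ≡ w

  codes? : ∀ S t w → Dec (Codes S t w)
  codes? S t w with code S t
  ... | nothing = no λ { (_ , () , _) }
  ... | just c  = map′ (λ eq → c , refl , eq) (λ { (_ , refl , eq) → eq }) (slot c Fin.≟ w)

  codes-functional : ∀ {S t w w′} → Codes S t w → Codes S t w′ → w ≡ w′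
  codes-functional (c , eq , refl) (c′ , eq′ , refl) = cong slot (just-injective (trans (≡-sym eq) eq′))

  codes-injective : ∀ {S t t′ w} → Codes S t w → Codes S t′ w → t ≡ t′
  codes-injective (c , eq , sc≡w) (c′ , eq′ , sc′≡w) =
    trans (≡-sym (proj₁ (code-sound eq)))
          (trans (cong ends (slot-injective (trans sc≡w (≡-sym sc′≡w)))) (proj₁ (code-sound eq′)))

  Marked : Subset n → Fin n → Set
  Marked S w = ∃[ t ] t ∉ S × Codes S t w

  marked? : ∀ S w → Dec (Marked S w)
  marked? S w = FinP.any? λ t → ¬? (t ∈? S) ×-dec codes? S t w

  marks : Subset n → Subset n
  marks S = tabulate λ w → does (marked? S w)

  ∈-marks⁺ : ∀ {S w} → Marked S w → w ∈ marks S
  ∈-marks⁺ {S} {w} marked =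
    VecP.lookup⇒[]= w (marks S) (trans (VecP.lookup∘tabulate _ w) (dec-true (marked? S w) marked))

  ∈-marks⁻ : ∀ {S w} → w ∈ marks S → Marked S w
  ∈-marks⁻ {S} {w} w∈ = witness (marked? S w) (trans (≡-sym (VecP.lookup∘tabulate _ w)) (VecP.[]=⇒lookup w∈))
    where
    witness : ∀ {A : Set} (a? : Dec A) → does a? ≡ true → A
    witness (yes a) _ = a

  marked-slot : ∀ {S c} → Marked S (slot c) → ends c ∉ S
  marked-slot {S} (t , t∉S , c′ , eq , sc′≡sc) =
    subst (_∉ S) (trans (≡-sym (proj₁ (code-sound eq))) (cong ends (slot-injective sc′≡sc))) t∉S

  φ : Subset n → Subset n
  φ S = ∁ (marks S)

  -- Every vertex outside φ S is the slot of some code c whose other end lies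
  -- in S, so the partner slot of c is not marked and dominates it.
  φ-dominating : ∀ S → Dominating M (φ S)
  φ-dominating S w with w ∈? φ S
  ... | yes w∈φS = inj₁ w∈φS
  ... | no  w∉φS with ∈-marks⁻ (x∉∁p⇒x∈p w∉φS)
  ...   | t , _ , c , eq , refl =
    inj₂ (slot (other c) , x∉p⇒x∈∁p (λ marked → marked-slot (∈-marks⁻ marked) (proj₂ (code-sound eq))) ,
          trans (sym M _ _) (Labelling.adjacent matching-labelling c))

  -- From φ S₁ ≡ φ S₂ the vertices outside a dominating S₁ are outside S₂:
  -- each is recovered as the end named by its (still marked) slot.
  outside-transfer : ∀ {S₁ S₂ t} → Dominating G S₁ → φ S₁ ≡ φ S₂ → t ∉ S₁ → t ∉ S₂
  outside-transfer {S₁} {S₂} dom φ≡ t∉S₁ with code-complete dom t∉S₁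
  ... | c , eq = subst (_∉ S₂) (proj₁ (code-sound eq)) (marked-slot (∈-marks⁻ (x∉∁p⇒x∈p slot∉φS₂)))
    where
    slot∉φS₂ : slot c ∉ φ S₂
    slot∉φS₂ = subst (slot c ∉_) φ≡ (x∈p⇒x∉∁p (∈-marks⁺ (_ , t∉S₁ , c , eq , refl)))

  φ-injective : ∀ {S₁ S₂} → Dominating G S₁ → Dominating G S₂ → φ S₁ ≡ φ S₂ → S₁ ≡ S₂
  φ-injective dom₁ dom₂ φ≡ =
    ⊆-antisym (⊆-by-complement (outside-transfer dom₂ (≡-sym φ≡)))
              (⊆-by-complement (outside-transfer dom₁ φ≡))

  -- For dominating S, coding is a bijection between the outside of S and the
  -- marks, so φ preserves cardinality.
  marks-size : ∀ {S} → Dominating G S → ∣ marks S ∣ ≡ ∣ ∁ S ∣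
  marks-size {S} dom = ℕP.≤-antisym
    (subset-pigeonhole (λ w t → t ∉ S × Codes S t w)
      (λ w∈ → let (t , t∉S , coded) = ∈-marks⁻ w∈ in t , x∉p⇒x∈∁p t∉S , t∉S , coded)
      (λ _ _ (_ , coded) (_ , coded′) → codes-functional coded coded′))
    (subset-pigeonhole (Codes S)
      (λ t∈∁S → let (c , eq) = code-complete dom (x∈∁p⇒x∉p t∈∁S)
                in slot c , ∈-marks⁺ (_ , x∈∁p⇒x∉p t∈∁S , c , eq , refl) , c , eq , refl)
      (λ _ _ → codes-injective))

  φ-size : ∀ {S} → Dominating G S → ∣ φ S ∣ ≡ ∣ S ∣
  φ-size {S} dom = begin
    ∣ ∁ (marks S) ∣    ≡⟨ ∣∁p∣≡n∸∣p∣ (marks S) ⟩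
    n ∸ ∣ marks S ∣    ≡⟨ cong (n ∸_) (marks-size dom) ⟩
    n ∸ ∣ ∁ S ∣        ≡⟨ ∣p∣≡n∸∣∁p∣ S ⟨
    ∣ S ∣              ∎
    where open ≡-Reasoning

  open DominationInjection {G = G} {H = M} φ (λ {S} _ → φ-dominating S) φ-size φ-injective public

module Matched {m r : ℕ} {G : Graph (2 * m + r)} (L : Labelling m G)
  (tight : ∀ {i} → 1 ≤ i → i ≤ 2 * m + r → d (mK₂∪rK₁ m r) i ≤ d G i) where
  open Labelling L
  open Matching m r
  open Compression L

  private
    M : Graph (2 * m + r)
    M = mK₂∪rK₁ m r

  partner∈ : ∀ c → slot (other c) ∈ ∁ ⁅ slot c ⁆
  partner∈ c = x∉p⇒x∈∁p (x≢y⇒x∉⁅y⁆ (λ eq → other-≢ c (slot-injective eq)))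

  cosingleton-dominating : ∀ c → Dominating M (∁ ⁅ slot c ⁆)
  cosingleton-dominating c v with v Fin.≟ slot c
  ... | no  v≢ = inj₁ (x∉p⇒x∈∁p (x≢y⇒x∉⁅y⁆ v≢))
  ... | yes refl =
    inj₂ (slot (other c) , partner∈ c , trans (sym M _ _) (Labelling.adjacent matching-labelling c))

  preimage : ∀ c → ∃[ S ] Dominating G S × φ S ≡ ∁ ⁅ slot c ⁆
  preimage c = φ-onto {∣ Y ∣} (tight {∣ Y ∣} (∈⇒1≤∣p∣ (partner∈ c)) (∣p∣≤n Y)) (cosingleton-dominating c) refl
    where
    Y : Subset (2 * m + r)
    Y = ∁ ⁅ slot c ⁆

  preimage-cosingleton : ∀ {S} c → Dominating G S → φ S ≡ ∁ ⁅ slot c ⁆ → S ≡ ∁ ⁅ ends c ⁆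
  preimage-cosingleton {S} c dom φS≡ = cosingleton-unique end∉S size
    where
    end∉S : ends c ∉ S
    end∉S = marked-slot (∈-marks⁻ (x∉∁p⇒x∈p (subst (slot c ∉_) (≡-sym φS≡) (x∈p⇒x∉∁p (x∈⁅x⁆ (slot c))))))
    size : ∣ S ∣ ≡ 2 * m + r ∸ 1
    size = trans (≡-sym (φ-size dom)) (trans (cong ∣_∣ φS≡) (∣∁⁅x⁆∣≡n∸1 (slot c)))

  φ-cosingleton : ∀ c → φ (∁ ⁅ ends c ⁆) ≡ ∁ ⁅ slot c ⁆
  φ-cosingleton c =
    let (S , dom , φS≡) = preimage c in trans (cong φ (≡-sym (preimage-cosingleton c dom φS≡))) φS≡

  ends-injective : Injective _≡_ _≡_ ends
  ends-injective {c} {c′} ends≡ = slot-injective (∁⁅⁆-injective (begin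
    ∁ ⁅ slot c ⁆      ≡⟨ φ-cosingleton c ⟨
    φ (∁ ⁅ ends c ⁆)  ≡⟨ cong (λ x → φ (∁ ⁅ x ⁆)) ends≡ ⟩
    φ (∁ ⁅ ends c′ ⁆) ≡⟨ φ-cosingleton c′ ⟩
    ∁ ⁅ slot c′ ⁆     ∎))
    where open ≡-Reasoning

labelling : ∀ {n m} (G : Graph n) → InGnm n m G → Labelling m G
labelling G eG = subst (λ k → Labelling k G) eG (edgeList-labelling G)

theorem2p5 : ∀ (m r : ℕ) → 1 ≤ m → UniqueOptimal (2 * m + r) m (mK₂∪rK₁ m r)
theorem2p5 m r _ = (matching-edgeCount , optimal) , unique
  where
  open Matching m r
  M : Graph (2 * m + r)
  M = mK₂∪rK₁ m r

  optimal : ∀ G → InGnm (2 * m + r) m G → ∀ x → 0ℚ ℚ.≤ x → D G x ℚ.≤ D M x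
  optimal G eG = D-mono G M (Compression.d-≤ (labelling G eG))

  -- an optimal H has D M 1 ≤ D H 1, so its coefficients are tight and its
  -- labelling injective, like that of M
  unique : ∀ H → Optimal (2 * m + r) m H → H ≅ M
  unique H (eH , H-optimal) =
    labelling-iso LH matching-labelling (Matched.ends-injective LH tight) slot-injective
    where
    LH : Labelling m H
    LH = labelling H eH
    tight : ∀ {i} → 1 ≤ i → i ≤ 2 * m + r → d M i ≤ d H i
    tight = coefficients-forced H M (Compression.d-≤ LH)
                                (H-optimal M matching-edgeCount 1ℚ (ℚP.nonNegative⁻¹ 1ℚ))
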